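{- Let $h:\mathbb{Z}_{\ge0}\to\mathbb{Z}_{\ge0}$ be a monotonically increasing function with the NS-property. Then for all nonnegative integers $y,z$ with $y\le h(z)$, the Sprague–Grundy value of the position $CB_2(h,y,z)$ of the two-dimensional chocolate game is $y\oplus z$.
   Context: A function $h:\mathbb{Z}_{\ge0}\to\mathbb{Z}_{\ge0}$ is monotonically increasing if $h(u)\le h(v)$ whenever $u\le v$. Such an $h$ has the NS-property if both of the following hold: - $h(0)=0$; - for all $z,z'\in\mathbb{Z}_{\ge0}$ and every positive integer $i$, $\lfloor z/2^i\rfloor=\lfloor z'/2^i\rfloor$ implies $\lfloor h(z)/2^{i-1}\rfloor=\lfloor h(z')/2^{i-1}\rfloor$. The two-dimensional chocolate game for $h$ is an impartial game under normal play (the player with no legal move loses). Its positions are $CB_2(h,y,z)$ with $y,z\in\mathbb{Z}_{\ge0}$ and $y\le h(z)$. The options of $CB_2(h,y,z)$ are: - $CB_2(h,v,z)$ for each $v<y$; - $CB_2(h,\min(y,h(w)),w)$ for each $w<z$. The Sprague–Grundy value is defined recursively by $\mathcal{G}(g)=\mathrm{mex}\{\mathcal{G}(g'): g' \text{ an option of } g\}$, where $\mathrm{mex}(S)$ is the least nonnegative integer not in $S$. The symbol $\oplus$ denotes bitwise XOR of nonnegative integers. -}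

module Defs where

open import Data.Nat using (ℕ; zero; suc; _+_; _*_; _^_; _≤_; _<_; _⊓_)
open import Data.Nat.Properties using (m^n≢0; _≟_)
open import Data.Nat.DivMod using (_/_; _%_)
open import Data.Product using (_×_)
open import Data.List using (List; []; _∷_; map; _++_; length; upTo)
open import Data.List.Relation.Unary.Any using (any?)
open import Relation.Nullary using (yes; no)
open import Relation.Binary.PropositionalEquality using (_≡_)

_/2^_ : ℕ → ℕ → ℕ
z /2^ i = (z / 2 ^ i) {{m^n≢0 2 i}}

Monotone : (ℕ → ℕ) → Set
Monotone h = ∀ u v → u ≤ v → h u ≤ h v

-- NS-property; the positive integer i is written suc i, so i-1 becomes i
NSProperty : (ℕ → ℕ) → Set
NSProperty h =
  (h 0 ≡ 0) ×
  (∀ z z' i → z /2^ suc i ≡ z' /2^ suc i → h z /2^ i ≡ h z' /2^ i)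

-- bitwise XOR, computed bit by bit with fuel (a + b bits always suffice)
xorFuel : ℕ → ℕ → ℕ → ℕ
xorFuel zero a b = 0
xorFuel (suc k) a b = (a % 2 + b % 2) % 2 + 2 * xorFuel k (a / 2) (b / 2)

_⊕_ : ℕ → ℕ → ℕ
a ⊕ b = xorFuel (a + b) a b

mexFrom : ℕ → ℕ → List ℕ → ℕ
mexFrom zero n xs = n
mexFrom (suc k) n xs with any? (n ≟_) xs
... | yes _ = mexFrom k (suc n) xs
... | no _ = n

mex : List ℕ → ℕ
mex xs = mexFrom (suc (length xs)) 0 xs

-- Options of CB₂(h,y,z): CB₂(h,v,z) for v < y, and CB₂(h, min(y,h w), w) for w < z.
-- Every option has strictly smaller y+z, so fuel y+z+1 suffices.
sgFuel : (ℕ → ℕ) → ℕ → ℕ → ℕ → ℕ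
sgFuel h zero y z = 0
sgFuel h (suc k) y z =
  mex (map (λ v → sgFuel h k v z) (upTo y) ++
       map (λ w → sgFuel h k (y ⊓ h w) w) (upTo z))

SG : (ℕ → ℕ) → ℕ → ℕ → ℕ
SG h y z = sgFuel h (suc (y + z)) y z

-- By induction, the options of CB₂(h,y,z) have the values v ⊕ z (v < y) and (y ⊓ h w) ⊕ w
-- (w < z), and each comparison is decided at the highest bit where two numbers differ.
-- The value y ⊕ z is missed: if w < z and h w < y ≤ h z, the NS-property makes h w and y agree
-- above the highest bit where w and z differ, so h w ⊕ w and y ⊕ z differ there.
-- Every m < y ⊕ z is hit: at the highest bit where m and y ⊕ z differ, y or z has a 0, and
-- xoring m with it gives v = m ⊕ z < y or w = m ⊕ y < z. In the second case, if h w < y, the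
-- NS-property lets one choose the lower bits of some u in the block of w one at a time so that
-- h u ⊕ u = m.
module Submission where

open import Defs
open import Data.Nat
open import Data.Nat.Properties
open import Data.Nat.DivMod
open import Data.Nat.Divisibility using (divides)
open import Data.Nat.Solver using (module +-*-Solver)
open import Data.Product using (∃; _×_; _,_)
open import Data.Sum using (_⊎_; inj₁; inj₂)
open import Data.Empty using (⊥-elim)
open import Data.List using (List; map; _++_; length; upTo)
open import Data.List.Properties using (length-++; length-map; length-upTo)
open import Data.List.Membership.Propositional using (_∈_; _∉_)
open import Data.List.Membership.Propositional.Properties
  using (∈-map⁺; ∈-map⁻; ∈-++⁺ˡ; ∈-++⁺ʳ; ∈-++⁻; ∈-upTo⁺; ∈-upTo⁻)
open import Data.List.Relation.Unary.Any using (any?)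
open import Relation.Nullary using (¬_; yes; no)
open import Relation.Binary.PropositionalEquality

m≡m%2+2*[m/2] : ∀ m → m ≡ m % 2 + 2 * (m / 2)
m≡m%2+2*[m/2] m = trans (m≡m%n+[m/n]*n m 2) (cong (m % 2 +_) (*-comm (m / 2) 2))

[b+2*q]/2≡q : ∀ b q → b < 2 → (b + 2 * q) / 2 ≡ q
[b+2*q]/2≡q b q b<2 = begin
  (b + 2 * q) / 2     ≡⟨ +-distrib-/-∣ʳ b (divides q (*-comm 2 q)) ⟩
  b / 2 + 2 * q / 2   ≡⟨ cong₂ _+_ (m<n⇒m/n≡0 b<2) (trans (/-congˡ (*-comm 2 q)) (m*n/n≡m q 2)) ⟩
  q                   ∎
  where open ≡-Reasoning

[b+2*q]%2≡b : ∀ b q → b < 2 → (b + 2 * q) % 2 ≡ b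
[b+2*q]%2≡b b q b<2 = trans (%-remove-+ʳ b (divides q (*-comm 2 q))) (m<n⇒m%n≡m b<2)

%2-/2-injective : ∀ {a b} → a % 2 ≡ b % 2 → a / 2 ≡ b / 2 → a ≡ b
%2-/2-injective {a} {b} a%2≡b%2 a/2≡b/2 =
  trans (m≡m%2+2*[m/2] a) (trans (cong₂ (λ r q → r + 2 * q) a%2≡b%2 a/2≡b/2) (sym (m≡m%2+2*[m/2] b)))

%2≡0⊎%2≡1 : ∀ a → a % 2 ≡ 0 ⊎ a % 2 ≡ 1
%2≡0⊎%2≡1 a with a % 2 | m%n<n a 2
... | 0 | _ = inj₁ refl
... | 1 | _ = inj₂ refl
... | suc (suc _) | s≤s (s≤s ())

[m%2+n]%2≡[m+n]%2 : ∀ m n → (m % 2 + n) % 2 ≡ (m + n) % 2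
[m%2+n]%2≡[m+n]%2 m n = begin
  (m % 2 + n) % 2           ≡⟨ %-distribˡ-+ (m % 2) n 2 ⟩
  (m % 2 % 2 + n % 2) % 2   ≡⟨ cong (λ r → (r + n % 2) % 2) (m%n%n≡m%n m 2) ⟩
  (m % 2 + n % 2) % 2       ≡⟨ %-distribˡ-+ m n 2 ⟨
  (m + n) % 2               ∎
  where open ≡-Reasoning

[m+n%2]%2≡[m+n]%2 : ∀ m n → (m + n % 2) % 2 ≡ (m + n) % 2
[m+n%2]%2≡[m+n]%2 m n = begin
  (m + n % 2) % 2   ≡⟨ cong (_% 2) (+-comm m (n % 2)) ⟩
  (n % 2 + m) % 2   ≡⟨ [m%2+n]%2≡[m+n]%2 n m ⟩
  (n + m) % 2       ≡⟨ cong (_% 2) (+-comm n m) ⟩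
  (m + n) % 2       ∎
  where open ≡-Reasoning

2*m≤1+n⇒m≤n : ∀ {m n} → 2 * m ≤ suc n → m ≤ n
2*m≤1+n⇒m≤n {m} {n} 2m≤1+n = s≤s⁻¹ (*-cancelˡ-< 2 m (suc n) (≤-<-trans 2m≤1+n (m<m+n (suc n) z<s)))

/2+/2≤pred : ∀ a b {k} → a + b ≤ suc k → a / 2 + b / 2 ≤ k
/2+/2≤pred a b a+b≤1+k = 2*m≤1+n⇒m≤n (begin
  2 * (a / 2 + b / 2)         ≡⟨ *-distribˡ-+ 2 (a / 2) (b / 2) ⟩
  2 * (a / 2) + 2 * (b / 2)   ≤⟨ +-mono-≤ (m≤n+m _ (a % 2)) (m≤n+m _ (b % 2)) ⟩
  (a % 2 + 2 * (a / 2)) + (b % 2 + 2 * (b / 2))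
                              ≡⟨ cong₂ _+_ (m≡m%2+2*[m/2] a) (m≡m%2+2*[m/2] b) ⟨
  a + b                       ≤⟨ a+b≤1+k ⟩
  suc _                       ∎)
  where open ≤-Reasoning

xorFuel-zeros : ∀ k → xorFuel k 0 0 ≡ 0
xorFuel-zeros zero = refl
xorFuel-zeros (suc k) = cong (2 *_) (xorFuel-zeros k)

xorFuel-irrelevant : ∀ {k k′} a b → a + b ≤ k → a + b ≤ k′ → xorFuel k a b ≡ xorFuel k′ a b
xorFuel-irrelevant {zero} {k′} zero zero _ _ = sym (xorFuel-zeros k′)
xorFuel-irrelevant {suc k} {zero} zero zero _ _ = xorFuel-zeros (suc k)
xorFuel-irrelevant {suc k} {suc k′} a b a+b≤k a+b≤k′ =
  cong (λ t → (a % 2 + b % 2) % 2 + 2 * t)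
       (xorFuel-irrelevant (a / 2) (b / 2) (/2+/2≤pred a b a+b≤k) (/2+/2≤pred a b a+b≤k′))

⊕-unfold : ∀ a b → a ⊕ b ≡ (a % 2 + b % 2) % 2 + 2 * ((a / 2) ⊕ (b / 2))
⊕-unfold zero zero = refl
⊕-unfold zero (suc b) =
  cong (λ t → (suc b % 2) % 2 + 2 * t)
       (xorFuel-irrelevant 0 (suc b / 2) (/2+/2≤pred 0 (suc b) ≤-refl) ≤-refl)
⊕-unfold (suc a) b =
  cong (λ t → (suc a % 2 + b % 2) % 2 + 2 * t)
       (xorFuel-irrelevant (suc a / 2) (b / 2) (/2+/2≤pred (suc a) b ≤-refl) ≤-refl)

⊕-/2 : ∀ a b → (a ⊕ b) / 2 ≡ (a / 2) ⊕ (b / 2)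
⊕-/2 a b = trans (/-congˡ (⊕-unfold a b)) ([b+2*q]/2≡q _ ((a / 2) ⊕ (b / 2)) (m%n<n (a % 2 + b % 2) 2))

⊕-%2 : ∀ a b → (a ⊕ b) % 2 ≡ (a % 2 + b % 2) % 2
⊕-%2 a b = trans (%-congˡ (⊕-unfold a b)) ([b+2*q]%2≡b _ ((a / 2) ⊕ (b / 2)) (m%n<n (a % 2 + b % 2) 2))

xorFuel≤+ : ∀ k a b → xorFuel k a b ≤ a + b
xorFuel≤+ zero a b = z≤n
xorFuel≤+ (suc k) a b = begin
  (a % 2 + b % 2) % 2 + 2 * xorFuel k (a / 2) (b / 2)
    ≤⟨ +-mono-≤ (m%n≤m (a % 2 + b % 2) 2) (*-monoʳ-≤ 2 (xorFuel≤+ k (a / 2) (b / 2))) ⟩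
  (a % 2 + b % 2) + 2 * (a / 2 + b / 2)
    ≡⟨ regroup (a % 2) (b % 2) (a / 2) (b / 2) ⟩
  (a % 2 + 2 * (a / 2)) + (b % 2 + 2 * (b / 2))
    ≡⟨ cong₂ _+_ (m≡m%2+2*[m/2] a) (m≡m%2+2*[m/2] b) ⟨
  a + b ∎
  where
  open ≤-Reasoning
  open +-*-Solver
  regroup : ∀ p q r s → (p + q) + 2 * (r + s) ≡ (p + 2 * r) + (q + 2 * s)
  regroup = solve 4 (λ p q r s → (p :+ q) :+ con 2 :* (r :+ s) := (p :+ con 2 :* r) :+ (q :+ con 2 :* s)) refl

⊕≤+ : ∀ a b → a ⊕ b ≤ a + b
⊕≤+ a b = xorFuel≤+ (a + b) a b

/2^-zero : ∀ a → a /2^ 0 ≡ a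
/2^-zero = n/1≡n

/2^-suc : ∀ a i → a /2^ suc i ≡ (a /2^ i) / 2
/2^-suc a i = sym (trans (m/n/o≡m/[n*o] a (2 ^ i) 2 {{m^n≢0 2 i}} {{_}} {{2^i*2≢0}})
                         (/-congʳ {{2^i*2≢0}} {{m^n≢0 2 (suc i)}} (*-comm (2 ^ i) 2)))
  where
  2^i*2≢0 : NonZero (2 ^ i * 2)
  2^i*2≢0 = m*n≢0 (2 ^ i) 2 {{m^n≢0 2 i}}

/2^-agree-halves : ∀ {a b} i → a /2^ suc i ≡ b /2^ suc i → (a /2^ i) / 2 ≡ (b /2^ i) / 2
/2^-agree-halves {a} {b} i agree = trans (sym (/2^-suc a i)) (trans agree (/2^-suc b i))

/2^-agree-suc : ∀ {a b} i → a /2^ i ≡ b /2^ i → a /2^ suc i ≡ b /2^ suc i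
/2^-agree-suc {a} {b} i a≡b = trans (/2^-suc a i) (trans (cong (_/ 2) a≡b) (sym (/2^-suc b i)))

/2^-mono-≤ : ∀ {a b} i → a ≤ b → a /2^ i ≤ b /2^ i
/2^-mono-≤ i = /-monoˡ-≤ (2 ^ i) {{m^n≢0 2 i}}

/2^-cancel-< : ∀ {a b} i → a /2^ i < b /2^ i → a < b
/2^-cancel-< {a} {b} i a′<b′ with a <? b
... | yes a<b = a<b
... | no a≮b = ⊥-elim (<⇒≱ a′<b′ (/2^-mono-≤ i (≮⇒≥ a≮b)))

/2^-squeeze : ∀ {lo p hi} i → lo ≤ p → p ≤ hi → lo /2^ i ≡ hi /2^ i → p /2^ i ≡ lo /2^ i
/2^-squeeze i lo≤p p≤hi lo≡hi =
  ≤-antisym (subst (_ ≤_) (sym lo≡hi) (/2^-mono-≤ i p≤hi)) (/2^-mono-≤ i lo≤p)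

*2^/2^ : ∀ q i → (q * 2 ^ i) /2^ i ≡ q
*2^/2^ q i = m*n/n≡m q (2 ^ i) {{m^n≢0 2 i}}

n<2^n : ∀ n → n < 2 ^ n
n<2^n zero = z<s
n<2^n (suc n) = begin-strict
  suc n             ≡⟨ +-comm 1 n ⟩
  n + 1             <⟨ +-mono-<-≤ (n<2^n n) (m^n>0 2 n) ⟩
  2 ^ n + 2 ^ n     ≡⟨ cong (2 ^ n +_) (+-identityʳ (2 ^ n)) ⟨
  2 ^ suc n         ∎
  where open ≤-Reasoning

m≤n⇒m/2^n≡0 : ∀ {m} n → m ≤ n → m /2^ n ≡ 0
m≤n⇒m/2^n≡0 n m≤n = m<n⇒m/n≡0 {{m^n≢0 2 n}} (≤-<-trans m≤n (n<2^n n))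

⊕-/2^ : ∀ a b i → (a ⊕ b) /2^ i ≡ (a /2^ i) ⊕ (b /2^ i)
⊕-/2^ a b zero = trans (/2^-zero (a ⊕ b)) (sym (cong₂ _⊕_ (/2^-zero a) (/2^-zero b)))
⊕-/2^ a b (suc i) = begin
  (a ⊕ b) /2^ suc i                     ≡⟨ /2^-suc (a ⊕ b) i ⟩
  ((a ⊕ b) /2^ i) / 2                   ≡⟨ cong (_/ 2) (⊕-/2^ a b i) ⟩
  ((a /2^ i) ⊕ (b /2^ i)) / 2           ≡⟨ ⊕-/2 (a /2^ i) (b /2^ i) ⟩
  ((a /2^ i) / 2) ⊕ ((b /2^ i) / 2)     ≡⟨ cong₂ _⊕_ (/2^-suc a i) (/2^-suc b i) ⟨
  (a /2^ suc i) ⊕ (b /2^ suc i)         ∎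
  where open ≡-Reasoning

highest-divergence : ∀ {a b} → a ≢ b → ∃ λ j → a /2^ suc j ≡ b /2^ suc j × a /2^ j ≢ b /2^ j
highest-divergence {a} {b} a≢b = search (a + b) agree-at-top
  where
  agree-at-top : a /2^ (a + b) ≡ b /2^ (a + b)
  agree-at-top = trans (m≤n⇒m/2^n≡0 (a + b) (m≤m+n a b)) (sym (m≤n⇒m/2^n≡0 (a + b) (m≤n+m b a)))
  search : ∀ J → a /2^ J ≡ b /2^ J → ∃ λ j → a /2^ suc j ≡ b /2^ suc j × a /2^ j ≢ b /2^ j
  search zero agree = ⊥-elim (a≢b (trans (sym (/2^-zero a)) (trans agree (/2^-zero b))))
  search (suc J) agree with a /2^ J ≟ b /2^ J
  ... | yes agree′ = search J agree′
  ... | no differ = J , agree , differ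

bit : ℕ → ℕ → ℕ
bit i a = (a /2^ i) % 2

bits-ext : ∀ {a b} → (∀ i → bit i a ≡ bit i b) → a ≡ b
bits-ext {a} {b} same-bits with a ≟ b
... | yes a≡b = a≡b
... | no a≢b with highest-divergence a≢b
...   | j , agree , differ =
  ⊥-elim (differ (%2-/2-injective (same-bits j) (/2^-agree-halves j agree)))

bit-⊕ : ∀ i a b → bit i (a ⊕ b) ≡ (bit i a + bit i b) % 2
bit-⊕ i a b = trans (cong (_% 2) (⊕-/2^ a b i)) (⊕-%2 (a /2^ i) (b /2^ i))

bit-zero : ∀ i → bit i 0 ≡ 0
bit-zero i = cong (_% 2) (m≤n⇒m/2^n≡0 i z≤n)

bit-idem : ∀ i a → bit i a % 2 ≡ bit i a
bit-idem i a = m%n%n≡m%n (a /2^ i) 2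

⊕-comm : ∀ a b → a ⊕ b ≡ b ⊕ a
⊕-comm a b = bits-ext λ i → begin
  bit i (a ⊕ b)               ≡⟨ bit-⊕ i a b ⟩
  (bit i a + bit i b) % 2     ≡⟨ cong (_% 2) (+-comm (bit i a) (bit i b)) ⟩
  (bit i b + bit i a) % 2     ≡⟨ bit-⊕ i b a ⟨
  bit i (b ⊕ a)               ∎
  where open ≡-Reasoning

⊕-assoc : ∀ a b c → (a ⊕ b) ⊕ c ≡ a ⊕ (b ⊕ c)
⊕-assoc a b c = bits-ext λ i → begin
  bit i ((a ⊕ b) ⊕ c)                         ≡⟨ bit-⊕ i (a ⊕ b) c ⟩
  (bit i (a ⊕ b) + bit i c) % 2               ≡⟨ cong (λ t → (t + bit i c) % 2) (bit-⊕ i a b) ⟩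
  ((bit i a + bit i b) % 2 + bit i c) % 2     ≡⟨ [m%2+n]%2≡[m+n]%2 (bit i a + bit i b) (bit i c) ⟩
  (bit i a + bit i b + bit i c) % 2           ≡⟨ cong (_% 2) (+-assoc (bit i a) (bit i b) (bit i c)) ⟩
  (bit i a + (bit i b + bit i c)) % 2         ≡⟨ [m+n%2]%2≡[m+n]%2 (bit i a) (bit i b + bit i c) ⟨
  (bit i a + (bit i b + bit i c) % 2) % 2     ≡⟨ cong (λ t → (bit i a + t) % 2) (bit-⊕ i b c) ⟨
  (bit i a + bit i (b ⊕ c)) % 2               ≡⟨ bit-⊕ i a (b ⊕ c) ⟨
  bit i (a ⊕ (b ⊕ c))                         ∎
  where open ≡-Reasoning

⊕-identityʳ : ∀ a → a ⊕ 0 ≡ a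
⊕-identityʳ a = bits-ext λ i → begin
  bit i (a ⊕ 0)               ≡⟨ bit-⊕ i a 0 ⟩
  (bit i a + bit i 0) % 2     ≡⟨ cong (λ t → (bit i a + t) % 2) (bit-zero i) ⟩
  (bit i a + 0) % 2           ≡⟨ cong (_% 2) (+-identityʳ (bit i a)) ⟩
  bit i a % 2                 ≡⟨ bit-idem i a ⟩
  bit i a                     ∎
  where open ≡-Reasoning

⊕-identityˡ : ∀ a → 0 ⊕ a ≡ a
⊕-identityˡ a = trans (⊕-comm 0 a) (⊕-identityʳ a)

⊕-same : ∀ a → a ⊕ a ≡ 0
⊕-same a = bits-ext λ i → begin
  bit i (a ⊕ a)               ≡⟨ bit-⊕ i a a ⟩
  (bit i a + bit i a) % 2     ≡⟨ cong (λ t → (bit i a + t) % 2) (+-identityʳ (bit i a)) ⟨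
  (2 * bit i a) % 2           ≡⟨ cong (_% 2) (*-comm 2 (bit i a)) ⟩
  (bit i a * 2) % 2           ≡⟨ m*n%n≡0 (bit i a) 2 ⟩
  0                           ≡⟨ bit-zero i ⟨
  bit i 0                     ∎
  where open ≡-Reasoning

⊕-involutiveˡ : ∀ a b → a ⊕ (a ⊕ b) ≡ b
⊕-involutiveˡ a b = trans (sym (⊕-assoc a a b)) (trans (cong (_⊕ b) (⊕-same a)) (⊕-identityˡ b))

⊕-involutiveʳ : ∀ a b → (b ⊕ a) ⊕ a ≡ b
⊕-involutiveʳ a b = trans (⊕-assoc b a a) (trans (cong (b ⊕_) (⊕-same a)) (⊕-identityʳ b))

⊕-cancelˡ : ∀ a {b c} → a ⊕ b ≡ a ⊕ c → b ≡ c
⊕-cancelˡ a {b} {c} eq = trans (sym (⊕-involutiveˡ a b)) (trans (cong (a ⊕_) eq) (⊕-involutiveˡ a c))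

⊕-cancelʳ : ∀ a {b c} → b ⊕ a ≡ c ⊕ a → b ≡ c
⊕-cancelʳ a {b} {c} eq = ⊕-cancelˡ a (trans (⊕-comm a b) (trans eq (⊕-comm c a)))

bit-⊕≡1 : ∀ i a b → bit i (a ⊕ b) ≡ 1 → bit i a ≡ 0 ⊎ bit i b ≡ 0
bit-⊕≡1 i a b odd with %2≡0⊎%2≡1 (a /2^ i) | %2≡0⊎%2≡1 (b /2^ i)
... | inj₁ a₀ | _ = inj₁ a₀
... | inj₂ _ | inj₁ b₀ = inj₂ b₀
... | inj₂ a₁ | inj₂ b₁ =
  ⊥-elim (0≢1+n (trans (sym (cong₂ (λ p q → (p + q) % 2) a₁ b₁)) (trans (sym (bit-⊕ i a b)) odd)))

/2≡∧parities⇒< : ∀ {A B} → A / 2 ≡ B / 2 → A % 2 ≡ 0 → B % 2 ≡ 1 → A < B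
/2≡∧parities⇒< {A} {B} A/2≡B/2 A-even B-odd = subst₂ _<_ (sym A≡) (sym B≡) (n<1+n (2 * (B / 2)))
  where
  A≡ : A ≡ 0 + 2 * (B / 2)
  A≡ = trans (m≡m%2+2*[m/2] A) (cong₂ (λ r q → r + 2 * q) A-even A/2≡B/2)
  B≡ : B ≡ 1 + 2 * (B / 2)
  B≡ = trans (m≡m%2+2*[m/2] B) (cong (_+ 2 * (B / 2)) B-odd)

<∧/2≡⇒parities : ∀ {A B} → A / 2 ≡ B / 2 → A < B → A % 2 ≡ 0 × B % 2 ≡ 1
<∧/2≡⇒parities {A} {B} A/2≡B/2 A<B with %2≡0⊎%2≡1 A | %2≡0⊎%2≡1 B
... | inj₁ A₀ | inj₂ B₁ = A₀ , B₁
... | inj₁ A₀ | inj₁ B₀ = ⊥-elim (<-irrefl (%2-/2-injective (trans A₀ (sym B₀)) A/2≡B/2) A<B)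
... | inj₂ A₁ | inj₂ B₁ = ⊥-elim (<-irrefl (%2-/2-injective (trans A₁ (sym B₁)) A/2≡B/2) A<B)
... | inj₂ A₁ | inj₁ B₀ = ⊥-elim (<-asym A<B (/2≡∧parities⇒< (sym A/2≡B/2) B₀ A₁))

record DivergeAt (i m x : ℕ) : Set where
  field
    agree-above : m /2^ suc i ≡ x /2^ suc i
    bit-m≡0 : bit i m ≡ 0
    bit-x≡1 : bit i x ≡ 1

module _ {i m x : ℕ} (d : DivergeAt i m x) where
  open DivergeAt d

  divergeAt-/2^-< : m /2^ i < x /2^ i
  divergeAt-/2^-< = /2≡∧parities⇒< (/2^-agree-halves i agree-above) bit-m≡0 bit-x≡1

  divergeAt⇒< : m < x
  divergeAt⇒< = /2^-cancel-< i divergeAt-/2^-<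

  divergeAt-⊕ : ∀ c → bit i c ≡ 0 → DivergeAt i (m ⊕ c) (x ⊕ c)
  divergeAt-⊕ c c₀ = record
    { agree-above = trans (⊕-/2^ m c (suc i))
                     (trans (cong (_⊕ (c /2^ suc i)) agree-above) (sym (⊕-/2^ x c (suc i))))
    ; bit-m≡0 = trans (bit-⊕ i m c) (cong₂ (λ p q → (p + q) % 2) bit-m≡0 c₀)
    ; bit-x≡1 = trans (bit-⊕ i x c) (cong₂ (λ p q → (p + q) % 2) bit-x≡1 c₀)
    }

<⇒divergeAt : ∀ {m x} → m < x → ∃ λ i → DivergeAt i m x
<⇒divergeAt {m} {x} m<x with highest-divergence (<⇒≢ m<x)
... | i , agree , differ
  with <∧/2≡⇒parities (/2^-agree-halves i agree) (≤∧≢⇒< (/2^-mono-≤ i (<⇒≤ m<x)) differ)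
...   | m₀ , x₁ = i , record { agree-above = agree ; bit-m≡0 = m₀ ; bit-x≡1 = x₁ }

-- The second clause of NSProperty.
NSBlocks : (ℕ → ℕ) → Set
NSBlocks h = ∀ z z′ i → z /2^ suc i ≡ z′ /2^ suc i → h z /2^ i ≡ h z′ /2^ i

module _ {h : ℕ → ℕ} (ns : NSBlocks h) where

  -- Above the highest bit where a and b differ, p and r both agree with h a, by NS.
  ⊕-injective-on-band : ∀ {a b p r} → a ≢ b →
                        h a ≤ p → p ≤ h b → h a ≤ r → r ≤ h b → p ⊕ a ≢ r ⊕ b
  ⊕-injective-on-band {a} {b} {p} {r} a≢b ha≤p p≤hb ha≤r r≤hb p⊕a≡r⊕b with highest-divergence a≢b
  ... | j , agree , differ = differ (⊕-cancelˡ (h a /2^ j) (begin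
      (h a /2^ j) ⊕ (a /2^ j)   ≡⟨ cong (_⊕ (a /2^ j)) p≈ha ⟨
      (p /2^ j) ⊕ (a /2^ j)     ≡⟨ ⊕-/2^ p a j ⟨
      (p ⊕ a) /2^ j             ≡⟨ cong (_/2^ j) p⊕a≡r⊕b ⟩
      (r ⊕ b) /2^ j             ≡⟨ ⊕-/2^ r b j ⟩
      (r /2^ j) ⊕ (b /2^ j)     ≡⟨ cong (_⊕ (b /2^ j)) r≈ha ⟩
      (h a /2^ j) ⊕ (b /2^ j)   ∎))
    where
    open ≡-Reasoning
    ha≈hb : h a /2^ j ≡ h b /2^ j
    ha≈hb = ns a b j agree
    p≈ha : p /2^ j ≡ h a /2^ j
    p≈ha = /2^-squeeze j ha≤p p≤hb ha≈hb
    r≈ha : r /2^ j ≡ h a /2^ j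
    r≈ha = /2^-squeeze j ha≤r r≤hb ha≈hb

  -- The multiple of 2 ^ j in u₀'s block at level suc j on which h u ⊕ u has the level-j prefix of t.
  recentre : ℕ → ℕ → ℕ → ℕ
  recentre j u₀ t = ((h u₀ /2^ j) ⊕ (t /2^ j)) * 2 ^ j

  module _ {j u₀ t : ℕ} (t≈ : t /2^ suc j ≡ (h u₀ ⊕ u₀) /2^ suc j) where
    private
      H = h u₀ /2^ j
      T = t /2^ j
      u₁ = recentre j u₀ t

    recentre-agree-above : u₁ /2^ suc j ≡ u₀ /2^ suc j
    recentre-agree-above = begin
      u₁ /2^ suc j                            ≡⟨ /2^-suc u₁ j ⟩
      (u₁ /2^ j) / 2                          ≡⟨ cong (_/ 2) (*2^/2^ (H ⊕ T) j) ⟩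
      (H ⊕ T) / 2                             ≡⟨ ⊕-/2 H T ⟩
      (H / 2) ⊕ (T / 2)                       ≡⟨ cong ((H / 2) ⊕_) T/2 ⟩
      (H / 2) ⊕ ((H / 2) ⊕ (u₀ /2^ suc j))    ≡⟨ ⊕-involutiveˡ (H / 2) (u₀ /2^ suc j) ⟩
      u₀ /2^ suc j                            ∎
      where
      open ≡-Reasoning
      T/2 : T / 2 ≡ (H / 2) ⊕ (u₀ /2^ suc j)
      T/2 = begin
        T / 2                                 ≡⟨ /2^-suc t j ⟨
        t /2^ suc j                           ≡⟨ t≈ ⟩
        (h u₀ ⊕ u₀) /2^ suc j                 ≡⟨ ⊕-/2^ (h u₀) u₀ (suc j) ⟩
        (h u₀ /2^ suc j) ⊕ (u₀ /2^ suc j)     ≡⟨ cong (_⊕ (u₀ /2^ suc j)) (/2^-suc (h u₀) j) ⟩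
        (H / 2) ⊕ (u₀ /2^ suc j)              ∎

    recentre-hits-level : t /2^ j ≡ (h u₁ ⊕ u₁) /2^ j
    recentre-hits-level = sym (begin
      (h u₁ ⊕ u₁) /2^ j             ≡⟨ ⊕-/2^ (h u₁) u₁ j ⟩
      (h u₁ /2^ j) ⊕ (u₁ /2^ j)     ≡⟨ cong₂ _⊕_ (ns u₁ u₀ j recentre-agree-above)
                                                 (*2^/2^ (H ⊕ T) j) ⟩
      H ⊕ (H ⊕ T)                   ≡⟨ ⊕-involutiveˡ H T ⟩
      T                             ∎)
      where open ≡-Reasoning

  h⊕id-onto-block : ∀ i u₀ t → t /2^ i ≡ (h u₀ ⊕ u₀) /2^ i →
                    ∃ λ u → u /2^ i ≡ u₀ /2^ i × h u ⊕ u ≡ t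
  h⊕id-onto-block zero u₀ t t≈ = u₀ , refl , sym (trans (sym (/2^-zero t)) (trans t≈ (/2^-zero _)))
  h⊕id-onto-block (suc j) u₀ t t≈
    with h⊕id-onto-block j (recentre j u₀ t) t (recentre-hits-level {j} {u₀} {t} t≈)
  ... | u , u≈u₁ , hu⊕u≡t =
    u , trans (/2^-agree-suc j u≈u₁) (recentre-agree-above {j} {u₀} {t} t≈) , hu⊕u≡t

ImageBelow : (ℕ → ℕ) → ℕ → ℕ → Set
ImageBelow f n a = ∃ λ k → k < n × f k ≡ a

-- The values that, inductively, the options CB₂(h,v,z) and CB₂(h,y ⊓ h w,w) of CB₂(h,y,z) take.
OptionValue : (ℕ → ℕ) → ℕ → ℕ → ℕ → Set
OptionValue h y z m = ImageBelow (_⊕ z) y m ⊎ ImageBelow (λ w → (y ⊓ h w) ⊕ w) z m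

module _ {h : ℕ → ℕ} (mono : Monotone h) (ns : NSBlocks h) where

  h<-of-⊕-twin : ∀ {y w u} → h w < y → y ⊕ w ≡ h u ⊕ u → h u < y
  h<-of-⊕-twin {y} {w} {u} hw<y y⊕w≡hu⊕u with y ≤? h u
  ... | no y≰hu = ≰⇒> y≰hu
  ... | yes y≤hu with u ≤? w
  ...   | yes u≤w = ⊥-elim (<⇒≱ hw<y (≤-trans y≤hu (mono u w u≤w)))
  ...   | no u≰w = ⊥-elim (⊕-injective-on-band ns (λ w≡u → u≰w (≤-reflexive (sym w≡u)))
                             (<⇒≤ hw<y) y≤hu (mono w u (<⇒≤ (≰⇒> u≰w))) ≤-refl y⊕w≡hu⊕u)

  module _ {y z : ℕ} (y≤hz : y ≤ h z) where

    y⊕z-not-option : ¬ OptionValue h y z (y ⊕ z)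
    y⊕z-not-option (inj₁ (v , v<y , v⊕z≡y⊕z)) = <-irrefl (⊕-cancelʳ z v⊕z≡y⊕z) v<y
    y⊕z-not-option (inj₂ (w , w<z , eq)) with y ≤? h w
    ... | yes y≤hw = <-irrefl (⊕-cancelˡ y (trans (cong (_⊕ w) (sym (m≤n⇒m⊓n≡m y≤hw))) eq)) w<z
    ... | no y≰hw = ⊕-injective-on-band ns (<⇒≢ w<z) ≤-refl (mono w z (<⇒≤ w<z)) (<⇒≤ hw<y) y≤hz
                      (trans (cong (_⊕ w) (sym (m≥n⇒m⊓n≡n (<⇒≤ hw<y)))) eq)
      where
      hw<y : h w < y
      hw<y = ≰⇒> y≰hw

    -- If h w < y, the option in column w has value h w ⊕ w, not y ⊕ w; a u in the block of w
    -- with h u ⊕ u = m is used instead.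
    column-option : ∀ {i m w} → DivergeAt i w z → y ⊕ w ≡ m → OptionValue h y z m
    column-option {i} {m} {w} d y⊕w≡m with y ≤? h w
    ... | yes y≤hw = inj₂ (w , divergeAt⇒< d , trans (cong (_⊕ w) (m≤n⇒m⊓n≡m y≤hw)) y⊕w≡m)
    ... | no y≰hw with h⊕id-onto-block ns i w m m≈
      where
      open ≡-Reasoning
      y≈hw : y /2^ i ≡ h w /2^ i
      y≈hw = /2^-squeeze i (<⇒≤ (≰⇒> y≰hw)) y≤hz (ns w z i (DivergeAt.agree-above d))
      m≈ : m /2^ i ≡ (h w ⊕ w) /2^ i
      m≈ = begin
        m /2^ i                     ≡⟨ cong (_/2^ i) y⊕w≡m ⟨
        (y ⊕ w) /2^ i               ≡⟨ ⊕-/2^ y w i ⟩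
        (y /2^ i) ⊕ (w /2^ i)       ≡⟨ cong (_⊕ (w /2^ i)) y≈hw ⟩
        (h w /2^ i) ⊕ (w /2^ i)     ≡⟨ ⊕-/2^ (h w) w i ⟨
        (h w ⊕ w) /2^ i             ∎
    ...   | u , u≈w , hu⊕u≡m =
      inj₂ (u , u<z , trans (cong (_⊕ u) (m≥n⇒m⊓n≡n (<⇒≤ hu<y))) hu⊕u≡m)
      where
      u<z : u < z
      u<z = /2^-cancel-< i (subst (_< z /2^ i) (sym u≈w) (divergeAt-/2^-< d))
      hu<y : h u < y
      hu<y = h<-of-⊕-twin (≰⇒> y≰hw) (trans y⊕w≡m (sym hu⊕u≡m))

    below-⊕-is-option : ∀ {m} → m < y ⊕ z → OptionValue h y z m
    below-⊕-is-option {m} m<y⊕z with <⇒divergeAt m<y⊕z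
    ... | i , d with bit-⊕≡1 i y z (DivergeAt.bit-x≡1 d)
    ...   | inj₂ z₀ = inj₁ (m ⊕ z , divergeAt⇒< d′ , ⊕-involutiveʳ z m)
      where
      d′ : DivergeAt i (m ⊕ z) y
      d′ = subst (DivergeAt i (m ⊕ z)) (⊕-involutiveʳ z y) (divergeAt-⊕ d z z₀)
    ...   | inj₁ y₀ = column-option d′ (trans (cong (y ⊕_) (⊕-comm m y)) (⊕-involutiveˡ y m))
      where
      d′ : DivergeAt i (m ⊕ y) z
      d′ = subst (DivergeAt i (m ⊕ y)) (trans (cong (_⊕ y) (⊕-comm y z)) (⊕-involutiveʳ y z))
                 (divergeAt-⊕ d y y₀)

mexFrom-spec : ∀ fuel s n xs → s ≤ n → n < s + fuel →
               n ∉ xs → (∀ m → s ≤ m → m < n → m ∈ xs) → mexFrom fuel s xs ≡ n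
mexFrom-spec zero s n xs s≤n n<s+0 _ _ = ⊥-elim (<⇒≱ n<s+0 (subst (_≤ n) (sym (+-identityʳ s)) s≤n))
mexFrom-spec (suc fuel) s n xs s≤n n<s+1+fuel n∉xs below∈xs with any? (s ≟_) xs | s ≟ n
... | yes s∈xs | yes refl = ⊥-elim (n∉xs s∈xs)
... | yes _    | no s≢n =
  mexFrom-spec fuel (suc s) n xs (≤∧≢⇒< s≤n s≢n) (subst (n <_) (+-suc s fuel) n<s+1+fuel)
               n∉xs (λ m s<m m<n → below∈xs m (<⇒≤ s<m) m<n)
... | no _     | yes s≡n = s≡n
... | no s∉xs  | no s≢n = ⊥-elim (s∉xs (below∈xs s ≤-refl (≤∧≢⇒< s≤n s≢n)))

mex-spec : ∀ xs n → n ≤ length xs → n ∉ xs → (∀ m → m < n → m ∈ xs) → mex xs ≡ n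
mex-spec xs n n≤len n∉xs below∈xs =
  mexFrom-spec (suc (length xs)) 0 n xs z≤n (s≤s n≤len) n∉xs (λ m _ → below∈xs m)

∈-map-upTo⁻ : ∀ {f n a} → a ∈ map f (upTo n) → ImageBelow f n a
∈-map-upTo⁻ a∈ with ∈-map⁻ _ a∈
... | k , k∈ , a≡fk = k , ∈-upTo⁻ k∈ , sym a≡fk

∈-map-upTo⁺ : ∀ {f n a} → ImageBelow f n a → a ∈ map f (upTo n)
∈-map-upTo⁺ {f} (k , k<n , refl) = ∈-map⁺ f (∈-upTo⁺ k<n)

ImageBelow-cong : ∀ {f g n a} → (∀ k → k < n → f k ≡ g k) → ImageBelow f n a → ImageBelow g n a
ImageBelow-cong f≗g (k , k<n , fk≡a) = k , k<n , trans (sym (f≗g k k<n)) fk≡a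

sgFuel≡⊕ : ∀ {h} → Monotone h → NSBlocks h →
           ∀ k y z → y + z < k → y ≤ h z → sgFuel h k y z ≡ y ⊕ z
sgFuel≡⊕ {h} mono ns (suc k) y z (s≤s y+z<k) y≤hz =
  mex-spec options (y ⊕ z) y⊕z≤length y⊕z∉options below∈options
  where
  row : ℕ → ℕ
  row v = sgFuel h k v z
  column : ℕ → ℕ
  column w = sgFuel h k (y ⊓ h w) w
  options : List ℕ
  options = map row (upTo y) ++ map column (upTo z)

  row≗ : ∀ v → v < y → row v ≡ v ⊕ z
  row≗ v v<y = sgFuel≡⊕ mono ns k v z (≤-trans (+-monoˡ-< z v<y) y+z<k) (≤-trans (<⇒≤ v<y) y≤hz)

  column≗ : ∀ w → w < z → column w ≡ (y ⊓ h w) ⊕ w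
  column≗ w w<z =
    sgFuel≡⊕ mono ns k (y ⊓ h w) w (≤-trans (+-mono-≤-< (m⊓n≤m y (h w)) w<z) y+z<k) (m⊓n≤n y (h w))

  y⊕z≤length : y ⊕ z ≤ length options
  y⊕z≤length = subst (y ⊕ z ≤_) (sym length-options) (⊕≤+ y z)
    where
    length-options : length options ≡ y + z
    length-options = trans (length-++ (map row (upTo y)))
      (cong₂ _+_ (trans (length-map row (upTo y)) (length-upTo y))
                 (trans (length-map column (upTo z)) (length-upTo z)))

  y⊕z∉options : y ⊕ z ∉ options
  y⊕z∉options y⊕z∈ with ∈-++⁻ (map row (upTo y)) y⊕z∈
  ... | inj₁ ∈rows = y⊕z-not-option mono ns y≤hz (inj₁ (ImageBelow-cong row≗ (∈-map-upTo⁻ ∈rows)))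
  ... | inj₂ ∈columns =
    y⊕z-not-option mono ns y≤hz (inj₂ (ImageBelow-cong column≗ (∈-map-upTo⁻ ∈columns)))

  below∈options : ∀ m → m < y ⊕ z → m ∈ options
  below∈options m m<y⊕z with below-⊕-is-option mono ns y≤hz m<y⊕z
  ... | inj₁ in-row = ∈-++⁺ˡ (∈-map-upTo⁺ (ImageBelow-cong (λ v v<y → sym (row≗ v v<y)) in-row))
  ... | inj₂ in-column =
    ∈-++⁺ʳ (map row (upTo y)) (∈-map-upTo⁺ (ImageBelow-cong (λ w w<z → sym (column≗ w w<z)) in-column))

corollary1 : (h : ℕ → ℕ) → Monotone h → NSProperty h →
    ∀ y z → y ≤ h z → SG h y z ≡ y ⊕ z
corollary1 h mono (_ , ns) y z y≤hz = sgFuel≡⊕ mono ns (suc (y + z)) y z (n<1+n (y + z)) y≤hz
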